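{- For all primes $p\geq 7$, \[ \sum_{n=1}^{p-1}\frac{(-1)^n}{n^2}\equiv\frac34\sum_{n=1}^{p-1}\frac1{n^2}\pmod{p^3}. \]
   Context: For rationals $x,y$, $x\equiv y\pmod{p^3}$ means the numerator of $x-y$ is divisible by $p^3$. -}

module Defs where

open import Data.Nat as ℕ using (ℕ; zero; suc)
open import Data.Integer as ℤ using (ℤ; +_)
open import Data.Integer.Divisibility as ℤD using ()
open import Data.Rational using (ℚ; 0ℚ; _+_; _-_; _/_; ↥_)

sumFrom1 : ℕ → (ℕ → ℚ) → ℚ
sumFrom1 zero    f = 0ℚ
sumFrom1 (suc m) f = sumFrom1 m f + f (suc m)

sign : ℕ → ℤ
sign zero    = + 1
sign (suc n) = ℤ.- sign n

-- (-1)^n / n^2  (value at n = 0 irrelevant; set to 0)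
altInvSq : ℕ → ℚ
altInvSq zero    = 0ℚ
altInvSq (suc k) = sign (suc k) / (suc k ℕ.* suc k)

invSq : ℕ → ℚ
invSq zero    = 0ℚ
invSq (suc k) = (+ 1) / (suc k ℕ.* suc k)

-- x ≡ y (mod m): the numerator of (x - y) (in lowest terms) is divisible by m
_≡_[modℚ_] : ℚ → ℚ → ℕ → Set
x ≡ y [modℚ m ] = (+ m) ℤD.∣ (↥ (x - y))

-- Write p = 2h + 1 and, for 1 ≤ m ≤ h, a = 1/m², b = 1/(p-2m)², c = 1/(p-m)², with sums A, B, C
-- over m and A₂, B₂, C₂ for the squares.  Splitting n < p into even and odd n, or pairing n with
-- p - n, gives  Σ 1/n² = A/4 + B = A + C,  Σ 1/n⁴ = A₂/16 + B₂ = A₂ + C₂  and  Σ (-1)ⁿ/n² = A/4 - B.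
-- With these relations 80 (Σ (-1)ⁿ/n² - ¾ Σ 1/n²) becomes the sum over m of
--   20 c + 20 a - 160 b - 15 p² a² + 16 p² (b² - c²),
-- since the p²-terms cancel.  Each summand is divisible by p³ in ℤ₍ₚ₎, as one sees by expanding
-- 1/(p-m)² and 1/(2m-p)² in powers of p/m; concretely, multiplied by (m (p-m) (p-2m))⁴ it becomes
-- p³ times an integer polynomial in m and p.  The factor 80 is a p-adic unit for p ≠ 2, 5.

module Submission where

open import Defs
open import Data.Nat using (ℕ; _≥_; _∸_; _^_)
open import Data.Nat.Primality using (Prime)
open import Data.Integer using (+_)
open import Data.Rational using (_*_; _/_)

open import Algebra.Bundles.Raw using (RawRing)
open import Data.Nat as ℕ using (zero; suc; _≤_; _<_; s≤s; z≤n)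
import Data.Nat.Properties as ℕₚ
open import Data.Nat.Tactic.RingSolver using (solve-∀)
open import Data.Integer as ℤ using (ℤ)
import Data.Integer.Properties as ℤₚ
import Data.Rational as ℚ
import Data.Rational.Properties as ℚₚ
open import Data.Rational.Unnormalised as ℚᵘ using (mkℚᵘ; *≡*)
import Data.Rational.Unnormalised.Properties as ℚᵘₚ
open import Data.Rational.Solver using (module +-*-Solver)
open import Data.Product using (Σ; _,_; proj₁; proj₂)
open import Data.Sum using (_⊎_; inj₁; inj₂; [_,_]′)
open import Data.Empty using (⊥-elim)
open import Data.Nat.Divisibility using (_∣_; _∤_; divides; ∣⇒≤; ∣-trans; 1∣_; m∣m*n; ∣m⇒∣m*n; *-monoʳ-∣; *-cancelˡ-∣)
open import Data.Nat.Primality using (euclidsLemma; prime⇒irreducible; prime⇒nonZero; prime⇒nonTrivial)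
open import Level using (0ℓ)
open import Relation.Binary.PropositionalEquality using (_≡_; refl; sym; trans; cong; cong₂; subst; module ≡-Reasoning)

open +-*-Solver using (Polynomial; solve; _:=_; con; _:+_; _:*_; :-_; _:-_)

-- Stated over any raw ring, so that the same formulas are read in ℚ, as solver polynomials, and
-- in the subring of integral rationals.
module Formulas {c ℓ} (R : RawRing c ℓ) (#_ : ℕ → RawRing.Carrier R) where
  open RawRing R renaming (_*_ to _·_)

  infixl 6 _-_
  _-_ : Carrier → Carrier → Carrier
  x - y = x + - y

  sq : Carrier → Carrier
  sq x = x · x

  pow : Carrier → ℕ → Carrier
  pow x zero    = 1#
  pow x (suc n) = x · pow x n

  combination : (A B C A₂ B₂ C₂ P : Carrier) → Carrier
  combination A B C A₂ B₂ C₂ P =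
    # 20 · C + # 20 · A - # 160 · B - # 15 · sq P · A₂ + # 16 · sq P · (B₂ - C₂)

  term : (a b c P : Carrier) → Carrier
  term a b c P = combination a b c (sq a) (sq b) (sq c) P

  denominator : (M P : Carrier) → Carrier
  denominator M P = sq (sq (M · (P - M) · (P - (M + M))))

  -- term a b c P · denominator M P, with a M², b (P - 2M)², c (P - M)² renamed α, β, γ
  cleared : (α β γ M P : Carrier) → Carrier
  cleared α β γ M P =
    # 20 · γ · (sq (sq M) · sq K · sq (sq J))
    + # 20 · α · (sq M · sq (sq K) · sq (sq J))
    - # 160 · β · (sq (sq M) · sq (sq K) · sq J)
    - # 15 · sq P · sq α · (sq (sq K) · sq (sq J))
    + # 16 · sq P · (sq β · (sq (sq M) · sq (sq K)) - sq γ · (sq (sq M) · sq (sq J)))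
    where
    K J : Carrier
    K = P - M
    J = P - (M + M)

  remainder : (M P : Carrier) → Carrier
  remainder M P =
    - (# 15 · pow P 7) + M · (# 180 · pow P 6 + M · (- (# 910 · pow P 5) + M · (# 2460 · pow P 4
    + M · (- (# 3715 · pow P 3) + M · (# 2944 · pow P 2 + M · (- (# 928 · P) - # 32 · M))))))

open import Data.Rational using (ℚ; 0ℚ; 1ℚ; _+_; -_; _-_; ↥_; ↧_; toℚᵘ)

fromℤ : ℤ → ℚ
fromℤ i = i / 1

fromℕ : ℕ → ℚ
fromℕ n = fromℤ (+ n)

toℚᵘ-fromℤ : ∀ i → toℚᵘ (fromℤ i) ℚᵘ.≃ mkℚᵘ i 0
toℚᵘ-fromℤ i = ℚₚ.toℚᵘ-fromℚᵘ (mkℚᵘ i 0)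

fromℤ-+ : ∀ i j → fromℤ (i ℤ.+ j) ≡ fromℤ i + fromℤ j
fromℤ-+ i j = ℚₚ.toℚᵘ-injective (begin
  toℚᵘ (fromℤ (i ℤ.+ j))             ≈⟨ toℚᵘ-fromℤ (i ℤ.+ j) ⟩
  mkℚᵘ (i ℤ.+ j) 0
    ≈⟨ *≡* (cong₂ (λ x y → (x ℤ.+ y) ℤ.* ℤ.+ 1) (sym (ℤₚ.*-identityʳ i)) (sym (ℤₚ.*-identityʳ j))) ⟩
  mkℚᵘ i 0 ℚᵘ.+ mkℚᵘ j 0              ≈⟨ ℚᵘₚ.+-cong (toℚᵘ-fromℤ i) (toℚᵘ-fromℤ j) ⟨
  toℚᵘ (fromℤ i) ℚᵘ.+ toℚᵘ (fromℤ j)  ≈⟨ ℚₚ.toℚᵘ-homo-+ (fromℤ i) (fromℤ j) ⟨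
  toℚᵘ (fromℤ i + fromℤ j)            ∎)
  where open ℚᵘₚ.≃-Reasoning

fromℤ-* : ∀ i j → fromℤ (i ℤ.* j) ≡ fromℤ i * fromℤ j
fromℤ-* i j = ℚₚ.toℚᵘ-injective (begin
  toℚᵘ (fromℤ (i ℤ.* j))             ≈⟨ toℚᵘ-fromℤ (i ℤ.* j) ⟩
  mkℚᵘ i 0 ℚᵘ.* mkℚᵘ j 0              ≈⟨ ℚᵘₚ.*-cong (toℚᵘ-fromℤ i) (toℚᵘ-fromℤ j) ⟨
  toℚᵘ (fromℤ i) ℚᵘ.* toℚᵘ (fromℤ j)  ≈⟨ ℚₚ.toℚᵘ-homo-* (fromℤ i) (fromℤ j) ⟨
  toℚᵘ (fromℤ i * fromℤ j)            ∎)
  where open ℚᵘₚ.≃-Reasoning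

fromℤ-neg : ∀ i → fromℤ (ℤ.- i) ≡ - fromℤ i
fromℤ-neg i = ℚₚ.toℚᵘ-injective (begin
  toℚᵘ (fromℤ (ℤ.- i))   ≈⟨ toℚᵘ-fromℤ (ℤ.- i) ⟩
  ℚᵘ.- mkℚᵘ i 0          ≈⟨ ℚᵘₚ.-‿cong (toℚᵘ-fromℤ i) ⟨
  ℚᵘ.- toℚᵘ (fromℤ i)    ≈⟨ ℚₚ.toℚᵘ-homo‿- (fromℤ i) ⟨
  toℚᵘ (- fromℤ i)       ∎)
  where open ℚᵘₚ.≃-Reasoning

fromℕ-+ : ∀ m n → fromℕ (m ℕ.+ n) ≡ fromℕ m + fromℕ n
fromℕ-+ m n = trans (cong fromℤ (sym (ℤₚ.pos-+ m n))) (fromℤ-+ (+ m) (+ n))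

fromℕ-* : ∀ m n → fromℕ (m ℕ.* n) ≡ fromℕ m * fromℕ n
fromℕ-* m n = trans (cong fromℤ (ℤₚ.pos-* m n)) (fromℤ-* (+ m) (+ n))

fromℕ-∸ : ∀ {m n} → n ≤ m → fromℕ (m ∸ n) ≡ fromℕ m - fromℕ n
fromℕ-∸ {m} {n} n≤m = begin
  fromℕ (m ∸ n)                      ≡⟨ solve 2 (λ x y → y := x :+ y :- x) refl (fromℕ n) (fromℕ (m ∸ n)) ⟩
  fromℕ n + fromℕ (m ∸ n) - fromℕ n  ≡⟨ cong (_- fromℕ n) (fromℕ-+ n (m ∸ n)) ⟨
  fromℕ (n ℕ.+ (m ∸ n)) - fromℕ n    ≡⟨ cong (λ k → fromℕ k - fromℕ n) (ℕₚ.m+[n∸m]≡n n≤m) ⟩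
  fromℕ m - fromℕ n                  ∎
  where open ≡-Reasoning

i/n*n≡i : ∀ i n .{{_ : ℕ.NonZero n}} → (i / n) * fromℕ n ≡ fromℤ i
i/n*n≡i i n@(suc d) = ℚₚ.toℚᵘ-injective (begin
  toℚᵘ ((i / n) * fromℕ n)            ≈⟨ ℚₚ.toℚᵘ-homo-* (i / n) (fromℕ n) ⟩
  toℚᵘ (i / n) ℚᵘ.* toℚᵘ (fromℕ n)    ≈⟨ ℚᵘₚ.*-cong (ℚₚ.toℚᵘ-fromℚᵘ (mkℚᵘ i d)) (toℚᵘ-fromℤ (+ n)) ⟩
  mkℚᵘ i d ℚᵘ.* mkℚᵘ (+ n) 0
    ≈⟨ *≡* (trans (ℤₚ.*-identityʳ _) (cong (λ k → i ℤ.* + k) (sym (ℕₚ.*-identityʳ n)))) ⟩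
  mkℚᵘ i 0                            ≈⟨ toℚᵘ-fromℤ i ⟨
  toℚᵘ (fromℤ i)                      ∎)
  where open ℚᵘₚ.≃-Reasoning

cross-multiply : ∀ x n z → x * fromℕ n ≡ fromℤ z → ↥ x ℤ.* + n ≡ z ℤ.* ↧ x
cross-multiply x@record{} n z eq = unfold product≃
  where
  open ℚᵘₚ.≃-Reasoning
  product≃ : toℚᵘ x ℚᵘ.* mkℚᵘ (+ n) 0 ℚᵘ.≃ mkℚᵘ z 0
  product≃ = begin
    toℚᵘ x ℚᵘ.* mkℚᵘ (+ n) 0    ≈⟨ ℚᵘₚ.*-congˡ {toℚᵘ x} (toℚᵘ-fromℤ (+ n)) ⟨
    toℚᵘ x ℚᵘ.* toℚᵘ (fromℕ n)  ≈⟨ ℚₚ.toℚᵘ-homo-* x (fromℕ n) ⟨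
    toℚᵘ (x * fromℕ n)          ≈⟨ ℚₚ.toℚᵘ-cong eq ⟩
    toℚᵘ (fromℤ z)              ≈⟨ toℚᵘ-fromℤ z ⟩
    mkℚᵘ z 0                    ∎
  unfold : toℚᵘ x ℚᵘ.* mkℚᵘ (+ n) 0 ℚᵘ.≃ mkℚᵘ z 0 → ↥ x ℤ.* + n ≡ z ℤ.* ↧ x
  unfold (*≡* e) = trans (sym (ℤₚ.*-identityʳ _)) (trans e (cong (λ k → z ℤ.* + k) (ℕₚ.*-identityʳ _)))

polynomials : ℕ → RawRing 0ℓ 0ℓ
polynomials n = record
  { Carrier = Polynomial n ; _≈_ = _≡_ ; _+_ = _:+_ ; _*_ = _:*_ ; -_ = :-_ ; 0# = con 0ℚ ; 1# = con 1ℚ }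

module Poly {n} = Formulas (polynomials n) (λ k → con (fromℕ k))
open Formulas ℚ.+-*-rawRing fromℕ using (sq; pow; combination; term; denominator; cleared; remainder)

fromℕ-^ : ∀ n k → fromℕ (n ^ k) ≡ pow (fromℕ n) k
fromℕ-^ n zero    = refl
fromℕ-^ n (suc k) = trans (fromℕ-* n (n ^ k)) (cong (fromℕ n *_) (fromℕ-^ n k))

term-identity : ∀ a b c M P → a * sq M ≡ 1ℚ → b * sq (P - (M + M)) ≡ 1ℚ → c * sq (P - M) ≡ 1ℚ →
                term a b c P * denominator M P ≡ pow P 3 * remainder M P
term-identity a b c M P aM²≡1 bJ²≡1 cK²≡1 = begin
  term a b c P * denominator M P
    ≡⟨ clear a b c M P ⟩
  cleared (a * sq M) (b * sq (P - (M + M))) (c * sq (P - M)) M P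
    ≡⟨ cong₂ (λ α β → cleared α β (c * sq (P - M)) M P) aM²≡1 bJ²≡1 ⟩
  cleared 1ℚ 1ℚ (c * sq (P - M)) M P
    ≡⟨ cong (λ γ → cleared 1ℚ 1ℚ γ M P) cK²≡1 ⟩
  cleared 1ℚ 1ℚ 1ℚ M P
    ≡⟨ factor M P ⟩
  pow P 3 * remainder M P  ∎
  where
  open ≡-Reasoning
  clear : ∀ a b c M P → term a b c P * denominator M P ≡
          cleared (a * sq M) (b * sq (P - (M + M))) (c * sq (P - M)) M P
  clear = solve 5 (λ a b c M P →
    Poly.term a b c P :* Poly.denominator M P :=
    Poly.cleared (a :* Poly.sq M) (b :* Poly.sq (P :- (M :+ M))) (c :* Poly.sq (P :- M)) M P) refl
  factor : ∀ M P → cleared 1ℚ 1ℚ 1ℚ M P ≡ pow P 3 * remainder M P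
  factor = solve 2 (λ M P → Poly.cleared (con 1ℚ) (con 1ℚ) (con 1ℚ) M P := Poly.pow P 3 :* Poly.remainder M P) refl

combination-0 : ∀ P → combination 0ℚ 0ℚ 0ℚ 0ℚ 0ℚ 0ℚ P ≡ 0ℚ
combination-0 = solve 1 (λ P → Poly.combination (con 0ℚ) (con 0ℚ) (con 0ℚ) (con 0ℚ) (con 0ℚ) (con 0ℚ) P := con 0ℚ) refl

combination-+ : ∀ A B C A₂ B₂ C₂ a b c a₂ b₂ c₂ P →
  combination A B C A₂ B₂ C₂ P + combination a b c a₂ b₂ c₂ P ≡
  combination (A + a) (B + b) (C + c) (A₂ + a₂) (B₂ + b₂) (C₂ + c₂) P
combination-+ = solve 13 (λ A B C A₂ B₂ C₂ a b c a₂ b₂ c₂ P →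
  Poly.combination A B C A₂ B₂ C₂ P :+ Poly.combination a b c a₂ b₂ c₂ P :=
  Poly.combination (A :+ a) (B :+ b) (C :+ c) (A₂ :+ a₂) (B₂ :+ b₂) (C₂ :+ c₂) P) refl

x+y≡z⇒y≡z-x : ∀ {x y z} → x + y ≡ z → y ≡ z - x
x+y≡z⇒y≡z-x {x} {y} refl = solve 2 (λ x y → y := x :+ y :- x) refl x y

combination-collapse : ∀ A B C A₂ B₂ C₂ P →
  A + C ≡ (+ 1 / 4) * A + B → A₂ + C₂ ≡ (+ 1 / 16) * A₂ + B₂ →
  combination A B C A₂ B₂ C₂ P ≡ fromℕ 80 * ((+ 1 / 4) * A - B - (+ 3 / 4) * ((+ 1 / 4) * A + B))
combination-collapse A B C A₂ B₂ C₂ P A+C≡ A₂+C₂≡ = begin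
  combination A B C A₂ B₂ C₂ P
    ≡⟨ cong₂ (λ C C₂ → combination A B C A₂ B₂ C₂ P) (x+y≡z⇒y≡z-x A+C≡) (x+y≡z⇒y≡z-x A₂+C₂≡) ⟩
  combination A B ((+ 1 / 4) * A + B - A) A₂ B₂ ((+ 1 / 16) * A₂ + B₂ - A₂) P
    ≡⟨ solve 5 (λ A B A₂ B₂ P →
         Poly.combination A B (con (+ 1 / 4) :* A :+ B :- A) A₂ B₂ (con (+ 1 / 16) :* A₂ :+ B₂ :- A₂) P :=
         con (fromℕ 80) :* (con (+ 1 / 4) :* A :- B :- con (+ 3 / 4) :* (con (+ 1 / 4) :* A :+ B))) refl A B A₂ B₂ P ⟩
  fromℕ 80 * ((+ 1 / 4) * A - B - (+ 3 / 4) * ((+ 1 / 4) * A + B))  ∎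
  where open ≡-Reasoning

Integral : ℚ → Set
Integral x = Σ ℤ λ z → x ≡ fromℤ z

integral-+ : ∀ {x y} → Integral x → Integral y → Integral (x + y)
integral-+ (i , refl) (j , refl) = i ℤ.+ j , sym (fromℤ-+ i j)

integral-* : ∀ {x y} → Integral x → Integral y → Integral (x * y)
integral-* (i , refl) (j , refl) = i ℤ.* j , sym (fromℤ-* i j)

integral-neg : ∀ {x} → Integral x → Integral (- x)
integral-neg (i , refl) = ℤ.- i , sym (fromℤ-neg i)

integralRationals : RawRing 0ℓ 0ℓ
integralRationals = record
  { Carrier = Σ ℚ Integral
  ; _≈_     = _≡_
  ; _+_     = λ x y → proj₁ x + proj₁ y , integral-+ (proj₂ x) (proj₂ y)
  ; _*_     = λ x y → proj₁ x * proj₁ y , integral-* (proj₂ x) (proj₂ y)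
  ; -_      = λ x → - proj₁ x , integral-neg (proj₂ x)
  ; 0#      = 0ℚ , + 0 , refl
  ; 1#      = 1ℚ , + 1 , refl
  }

-- Evaluating remainder in the ring of integral rationals certifies that its value is an integer.
remainder-integral : ∀ m n → Integral (remainder (fromℕ m) (fromℕ n))
remainder-integral m n = proj₂ (Formulas.remainder integralRationals embed (embed m) (embed n))
  where
  embed : ℕ → Σ ℚ Integral
  embed k = fromℕ k , + k , refl

invSq-*-sq : ∀ {n} → 1 ≤ n → invSq n * sq (fromℕ n) ≡ 1ℚ
invSq-*-sq {suc k} _ = trans (cong (invSq (suc k) *_) (sym (fromℕ-* (suc k) (suc k)))) (i/n*n≡i (+ 1) (suc k ℕ.* suc k))

invSq-∸-*-sq : ∀ {m n} → m < n → invSq (n ∸ m) * sq (fromℕ n - fromℕ m) ≡ 1ℚ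
invSq-∸-*-sq {m} {n} m<n =
  subst (λ K → invSq (n ∸ m) * sq K ≡ 1ℚ) (fromℕ-∸ (ℕₚ.<⇒≤ m<n)) (invSq-*-sq (ℕₚ.m<n⇒0<n∸m m<n))

denominator-fromℕ : ∀ {m n} → m ℕ.+ m ≤ n →
  denominator (fromℕ m) (fromℕ n) ≡ fromℕ ((m ℕ.* (n ∸ m) ℕ.* (n ∸ (m ℕ.+ m))) ^ 4)
denominator-fromℕ {m} {n} 2m≤n = begin
  sq (sq (M * (N - M) * (N - (M + M))))
    ≡⟨ cong₂ (λ K J → sq (sq (M * K * J))) (fromℕ-∸ (ℕₚ.≤-trans (ℕₚ.m≤m+n m m) 2m≤n))
                                          (trans (fromℕ-∸ 2m≤n) (cong (_-_ N) (fromℕ-+ m m))) ⟨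
  sq (sq (M * fromℕ (n ∸ m) * fromℕ (n ∸ (m ℕ.+ m))))
    ≡⟨ cong (λ x → sq (sq x)) (trans (fromℕ-* (m ℕ.* (n ∸ m)) (n ∸ (m ℕ.+ m)))
                                     (cong (_* fromℕ (n ∸ (m ℕ.+ m))) (fromℕ-* m (n ∸ m)))) ⟨
  sq (sq (fromℕ u))  ≡⟨ solve 1 (λ x → Poly.sq (Poly.sq x) := Poly.pow x 4) refl (fromℕ u) ⟩
  pow (fromℕ u) 4    ≡⟨ fromℕ-^ u 4 ⟨
  fromℕ (u ^ 4)      ∎
  where
  open ≡-Reasoning
  M N : ℚ
  M = fromℕ m
  N = fromℕ n
  u : ℕ
  u = m ℕ.* (n ∸ m) ℕ.* (n ∸ (m ℕ.+ m))

inverse-sq-double : ∀ x y M → x * sq (M + M) ≡ 1ℚ → y * sq M ≡ 1ℚ → x ≡ (+ 1 / 4) * y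
inverse-sq-double x y M x[2M]²≡1 yM²≡1 = begin
  x                                  ≡⟨ ℚₚ.*-identityʳ x ⟨
  x * 1ℚ                             ≡⟨ cong (x *_) yM²≡1 ⟨
  x * (y * sq M)                     ≡⟨ solve 3 (λ x y M → x :* (y :* (M :* M)) :=
                                          con (+ 1 / 4) :* y :* (x :* ((M :+ M) :* (M :+ M)))) refl x y M ⟩
  (+ 1 / 4) * y * (x * sq (M + M))  ≡⟨ cong ((+ 1 / 4) * y *_) x[2M]²≡1 ⟩
  (+ 1 / 4) * y * 1ℚ                ≡⟨ ℚₚ.*-identityʳ _ ⟩
  (+ 1 / 4) * y                     ∎
  where open ≡-Reasoning

invSq-double : ∀ {m} → 1 ≤ m → invSq (m ℕ.+ m) ≡ (+ 1 / 4) * invSq m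
invSq-double {m} 1≤m = inverse-sq-double (invSq (m ℕ.+ m)) (invSq m) (fromℕ m)
  (subst (λ x → invSq (m ℕ.+ m) * sq x ≡ 1ℚ) (fromℕ-+ m m) (invSq-*-sq (ℕₚ.≤-trans 1≤m (ℕₚ.m≤m+n m m))))
  (invSq-*-sq 1≤m)

sq-invSq-double : ∀ {m} → 1 ≤ m → sq (invSq (m ℕ.+ m)) ≡ (+ 1 / 16) * sq (invSq m)
sq-invSq-double {m} 1≤m = trans (cong sq (invSq-double 1≤m))
  (solve 1 (λ y → (con (+ 1 / 4) :* y) :* (con (+ 1 / 4) :* y) := con (+ 1 / 16) :* (y :* y)) refl (invSq m))

sign-double : ∀ r → sign (r ℕ.+ r) ≡ + 1
sign-double zero    = refl
sign-double (suc r) rewrite ℕₚ.+-suc r r | sign-double r = refl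

altInvSq-even : ∀ {m} → 1 ≤ m → altInvSq (m ℕ.+ m) ≡ invSq (m ℕ.+ m)
altInvSq-even {suc j} _ rewrite sign-double (suc j) = refl

altInvSq-odd : ∀ r → altInvSq (suc (r ℕ.+ r)) ≡ - invSq (suc (r ℕ.+ r))
altInvSq-odd r rewrite sign-double r = refl

sumFrom1-cong : ∀ n {f g : ℕ → ℚ} → (∀ {m} → 1 ≤ m → m ≤ n → f m ≡ g m) → sumFrom1 n f ≡ sumFrom1 n g
sumFrom1-cong zero    f≗g = refl
sumFrom1-cong (suc n) f≗g =
  cong₂ _+_ (sumFrom1-cong n (λ 1≤m m≤n → f≗g 1≤m (ℕₚ.m≤n⇒m≤1+n m≤n))) (f≗g (s≤s z≤n) ℕₚ.≤-refl)

sumFrom1-suc : ∀ n f → sumFrom1 (suc n) f ≡ f 1 + sumFrom1 n (λ m → f (suc m))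
sumFrom1-suc zero    f = trans (ℚₚ.+-identityˡ (f 1)) (sym (ℚₚ.+-identityʳ (f 1)))
sumFrom1-suc (suc n) f = trans (cong (_+ f (suc (suc n))) (sumFrom1-suc n f)) (ℚₚ.+-assoc (f 1) _ _)

sumFrom1-reverse : ∀ n f → sumFrom1 n (λ m → f (suc n ∸ m)) ≡ sumFrom1 n f
sumFrom1-reverse zero    f = refl
sumFrom1-reverse (suc n) f = begin
  sumFrom1 n (λ m → f (suc (suc n) ∸ m)) + f (suc n ∸ n)
    ≡⟨ cong₂ _+_ (sumFrom1-cong n (λ _ m≤n → cong f (ℕₚ.+-∸-assoc 1 (ℕₚ.m≤n⇒m≤1+n m≤n))))
                 (cong f (ℕₚ.m+n∸n≡m 1 n)) ⟩
  sumFrom1 n (λ m → f (suc (suc n ∸ m))) + f 1  ≡⟨ cong (_+ f 1) (sumFrom1-reverse n (λ m → f (suc m))) ⟩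
  sumFrom1 n (λ m → f (suc m)) + f 1            ≡⟨ ℚₚ.+-comm _ (f 1) ⟩
  f 1 + sumFrom1 n (λ m → f (suc m))            ≡⟨ sumFrom1-suc n f ⟨
  sumFrom1 (suc n) f                            ∎
  where open ≡-Reasoning

sumFrom1-+ : ∀ m n f → sumFrom1 (m ℕ.+ n) f ≡ sumFrom1 m f + sumFrom1 n (λ k → f (m ℕ.+ k))
sumFrom1-+ m zero    f rewrite ℕₚ.+-identityʳ m = sym (ℚₚ.+-identityʳ (sumFrom1 m f))
sumFrom1-+ m (suc n) f rewrite ℕₚ.+-suc m n =
  trans (cong (_+ f (suc (m ℕ.+ n))) (sumFrom1-+ m n f)) (ℚₚ.+-assoc (sumFrom1 m f) _ _)

sumFrom1-split-even-odd : ∀ h f → sumFrom1 (h ℕ.+ h) f ≡ sumFrom1 h (λ m → f (m ℕ.+ m)) + sumFrom1 h (λ m → f (m ℕ.+ m ∸ 1))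
sumFrom1-split-even-odd zero    f = sym (ℚₚ.+-identityʳ 0ℚ)
sumFrom1-split-even-odd (suc h) f rewrite ℕₚ.+-suc h h =
  trans (cong (λ s → s + f (suc (h ℕ.+ h)) + f (suc (suc (h ℕ.+ h)))) (sumFrom1-split-even-odd h f))
        (solve 4 (λ E O x y → E :+ O :+ x :+ y := E :+ y :+ (O :+ x)) refl
          (sumFrom1 h (λ m → f (m ℕ.+ m))) (sumFrom1 h (λ m → f (m ℕ.+ m ∸ 1))) (f (suc (h ℕ.+ h))) (f (suc (suc (h ℕ.+ h)))))

sumFrom1-*ˡ : ∀ n x f → sumFrom1 n (λ m → x * f m) ≡ x * sumFrom1 n f
sumFrom1-*ˡ zero    x f = sym (ℚₚ.*-zeroʳ x)
sumFrom1-*ˡ (suc n) x f = trans (cong (_+ x * f (suc n)) (sumFrom1-*ˡ n x f)) (sym (ℚₚ.*-distribˡ-+ x (sumFrom1 n f) (f (suc n))))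

sumFrom1-neg : ∀ n f → sumFrom1 n (λ m → - f m) ≡ - sumFrom1 n f
sumFrom1-neg zero    f = refl
sumFrom1-neg (suc n) f = trans (cong (_+ - f (suc n)) (sumFrom1-neg n f)) (sym (ℚₚ.neg-distrib-+ (sumFrom1 n f) (f (suc n))))

sumFrom1-combination : ∀ n (f g h f₂ g₂ h₂ : ℕ → ℚ) P →
  sumFrom1 n (λ m → combination (f m) (g m) (h m) (f₂ m) (g₂ m) (h₂ m) P) ≡
  combination (sumFrom1 n f) (sumFrom1 n g) (sumFrom1 n h) (sumFrom1 n f₂) (sumFrom1 n g₂) (sumFrom1 n h₂) P
sumFrom1-combination zero    f g h f₂ g₂ h₂ P = sym (combination-0 P)
sumFrom1-combination (suc n) f g h f₂ g₂ h₂ P =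
  trans (cong (_+ combination (f k) (g k) (h k) (f₂ k) (g₂ k) (h₂ k) P) (sumFrom1-combination n f g h f₂ g₂ h₂ P))
        (combination-+ (S f) (S g) (S h) (S f₂) (S g₂) (S h₂) (f k) (g k) (h k) (f₂ k) (g₂ k) (h₂ k) P)
  where
  k : ℕ
  k = suc n
  S : (ℕ → ℚ) → ℚ
  S = sumFrom1 n

∸-double-odd : ∀ {m h} → m ≤ h → suc (h ℕ.+ h) ∸ (m ℕ.+ m) ≡ suc ((h ∸ m) ℕ.+ (h ∸ m))
∸-double-odd {m} {h} m≤h = begin
  suc (h ℕ.+ h) ∸ (m ℕ.+ m)              ≡⟨ cong (λ k → suc (k ℕ.+ k) ∸ (m ℕ.+ m)) (ℕₚ.m+[n∸m]≡n m≤h) ⟨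
  suc ((m ℕ.+ r) ℕ.+ (m ℕ.+ r)) ∸ (m ℕ.+ m) ≡⟨ cong (_∸ (m ℕ.+ m)) (regroup m r) ⟩
  (m ℕ.+ m) ℕ.+ suc (r ℕ.+ r) ∸ (m ℕ.+ m)  ≡⟨ ℕₚ.m+n∸m≡n (m ℕ.+ m) (suc (r ℕ.+ r)) ⟩
  suc (r ℕ.+ r)                          ∎
  where
  open ≡-Reasoning
  r : ℕ
  r = h ∸ m
  regroup : ∀ m r → suc ((m ℕ.+ r) ℕ.+ (m ℕ.+ r)) ≡ (m ℕ.+ m) ℕ.+ suc (r ℕ.+ r)
  regroup = solve-∀

sumFrom1-split-reflectedHalf : ∀ h f → sumFrom1 (h ℕ.+ h) f ≡ sumFrom1 h f + sumFrom1 h (λ m → f (suc (h ℕ.+ h) ∸ m))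
sumFrom1-split-reflectedHalf h f = trans (sumFrom1-+ h h f) (cong (_+_ (sumFrom1 h f))
  (trans (sym (sumFrom1-reverse h (λ m → f (h ℕ.+ m)))) (sumFrom1-cong h (λ _ m≤h → cong f (reflect m≤h)))))
  where
  reflect : ∀ {m} → m ≤ h → h ℕ.+ (suc h ∸ m) ≡ suc (h ℕ.+ h) ∸ m
  reflect {m} m≤h = trans (sym (ℕₚ.+-∸-assoc h (ℕₚ.m≤n⇒m≤1+n m≤h))) (cong (_∸ m) (ℕₚ.+-suc h h))

sumFrom1-split-even-reflectedOdd : ∀ h f →
  sumFrom1 (h ℕ.+ h) f ≡ sumFrom1 h (λ m → f (m ℕ.+ m)) + sumFrom1 h (λ m → f (suc (h ℕ.+ h) ∸ (m ℕ.+ m)))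
sumFrom1-split-even-reflectedOdd h f = trans (sumFrom1-split-even-odd h f) (cong (_+_ (sumFrom1 h (λ m → f (m ℕ.+ m))))
  (trans (sym (sumFrom1-reverse h (λ m → f (m ℕ.+ m ∸ 1)))) (sumFrom1-cong h (λ _ m≤h → cong f (reflect m≤h)))))
  where
  reflect : ∀ {m} → m ≤ h → (suc h ∸ m) ℕ.+ (suc h ∸ m) ∸ 1 ≡ suc (h ℕ.+ h) ∸ (m ℕ.+ m)
  reflect {m} m≤h = begin
    (suc h ∸ m) ℕ.+ (suc h ∸ m) ∸ 1  ≡⟨ cong (λ k → k ℕ.+ k ∸ 1) (ℕₚ.+-∸-assoc 1 m≤h) ⟩
    (h ∸ m) ℕ.+ suc (h ∸ m)          ≡⟨ ℕₚ.+-suc (h ∸ m) (h ∸ m) ⟩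
    suc ((h ∸ m) ℕ.+ (h ∸ m))        ≡⟨ ∸-double-odd m≤h ⟨
    suc (h ℕ.+ h) ∸ (m ℕ.+ m)        ∎
    where open ≡-Reasoning

parity : ∀ n → Σ ℕ (λ h → n ≡ h ℕ.+ h) ⊎ Σ ℕ (λ h → n ≡ suc (h ℕ.+ h))
parity zero = inj₁ (0 , refl)
parity (suc n) with parity n
... | inj₁ (h , n≡2h)   = inj₂ (h , cong suc n≡2h)
... | inj₂ (h , n≡2h+1) = inj₁ (suc h , trans (cong suc n≡2h+1) (cong suc (sym (ℕₚ.+-suc h h))))

prime>2⇒odd : ∀ {p} → Prime p → 2 < p → Σ ℕ λ h → p ≡ suc (h ℕ.+ h)
prime>2⇒odd {p} isPrime 2<p with parity p
... | inj₂ odd = odd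
... | inj₁ (h , refl) with prime⇒irreducible isPrime (divides h (sym (trans (ℕₚ.*-comm h 2) (cong (h ℕ.+_) (ℕₚ.+-identityʳ h)))))
...   | inj₁ ()
...   | inj₂ 2≡p = ⊥-elim (ℕₚ.<⇒≢ 2<p 2≡p)

module Valuation {p : ℕ} (isPrime : Prime p) where

  ∤-pos-< : ∀ {n} → 1 ≤ n → n < p → p ∤ n
  ∤-pos-< {suc n} _ n<p p∣n = ℕₚ.<⇒≱ n<p (∣⇒≤ p∣n)

  ∤-∸ : ∀ {n} → 1 ≤ n → n < p → p ∤ p ∸ n
  ∤-∸ {n} 1≤n n<p = ∤-pos-< (ℕₚ.m<n⇒0<n∸m n<p) (ℕₚ.∸-monoʳ-< {p} {n} {0} 1≤n (ℕₚ.<⇒≤ n<p))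

  ∤-* : ∀ {m n} → p ∤ m → p ∤ n → p ∤ m ℕ.* n
  ∤-* {m} {n} p∤m p∤n p∣mn = [ p∤m , p∤n ]′ (euclidsLemma m n isPrime p∣mn)

  p∤1 : p ∤ 1
  p∤1 = ∤-pos-< ℕₚ.≤-refl (ℕ.nonTrivial⇒n>1 p {{prime⇒nonTrivial isPrime}})

  ∤-^ : ∀ {n} → p ∤ n → ∀ k → p ∤ n ^ k
  ∤-^ p∤n zero    = p∤1
  ∤-^ p∤n (suc k) = ∤-* p∤n (∤-^ p∤n k)

  ≥7⇒∤80 : 7 ≤ p → p ∤ 80
  ≥7⇒∤80 7≤p = ∤-* p∤2 (∤-* p∤2 (∤-* p∤2 (∤-* p∤2 p∤5)))
    where
    5<p : 5 < p
    5<p = ℕₚ.≤-trans (ℕₚ.n≤1+n 6) 7≤p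
    p∤2 : p ∤ 2
    p∤2 = ∤-pos-< (s≤s z≤n) (ℕₚ.≤-trans (s≤s (s≤s (s≤s z≤n))) 5<p)
    p∤5 : p ∤ 5
    p∤5 = ∤-pos-< (s≤s z≤n) 5<p

  p^k∣m*n⇒p^k∣m : ∀ {n} → p ∤ n → ∀ k m → p ^ k ∣ m ℕ.* n → p ^ k ∣ m
  p^k∣m*n⇒p^k∣m p∤n zero    m _ = 1∣ m
  p^k∣m*n⇒p^k∣m {n} p∤n (suc k) m p^[1+k]∣mn with euclidsLemma m n isPrime (∣-trans (m∣m*n (p ^ k)) p^[1+k]∣mn)
  ... | inj₂ p∣n = ⊥-elim (p∤n p∣n)
  ... | inj₁ (divides q refl) = subst (p ^ suc k ∣_) (ℕₚ.*-comm p q)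
          (*-monoʳ-∣ p (p^k∣m*n⇒p^k∣m p∤n k q
            (*-cancelˡ-∣ p {{prime⇒nonZero isPrime}} (subst (p ^ suc k ∣_) regroup p^[1+k]∣mn))))
    where
    regroup : q ℕ.* p ℕ.* n ≡ p ℕ.* (q ℕ.* n)
    regroup = trans (cong (ℕ._* n) (ℕₚ.*-comm q p)) (ℕₚ.*-assoc p q n)

  -- k ≤ᵥ x  means  k ≤ v_p(x)
  infix 4 _≤ᵥ_
  record _≤ᵥ_ (k : ℕ) (x : ℚ) : Set where
    constructor witness
    field
      u   : ℕ
      p∤u : p ∤ u
      z   : ℤ
      x*u≡pᵏ*z : x * fromℕ u ≡ fromℕ (p ^ k) * fromℤ z

  ≤ᵥ-0ℚ : ∀ k → k ≤ᵥ 0ℚ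
  ≤ᵥ-0ℚ k = witness 1 p∤1 (+ 0) (sym (ℚₚ.*-zeroʳ (fromℕ (p ^ k))))

  ≤ᵥ-+ : ∀ {k x y} → k ≤ᵥ x → k ≤ᵥ y → k ≤ᵥ x + y
  ≤ᵥ-+ {k} {x} {y} (witness u p∤u i xu≡) (witness v p∤v j yv≡) =
    witness (u ℕ.* v) (∤-* p∤u p∤v) (i ℤ.* + v ℤ.+ j ℤ.* + u) (begin
    (x + y) * fromℕ (u ℕ.* v)                          ≡⟨ cong ((x + y) *_) (fromℕ-* u v) ⟩
    (x + y) * (U * V)
      ≡⟨ solve 4 (λ x y U V → (x :+ y) :* (U :* V) := x :* U :* V :+ y :* V :* U) refl x y U V ⟩
    x * U * V + y * V * U                              ≡⟨ cong₂ (λ s t → s * V + t * U) xu≡ yv≡ ⟩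
    Pᵏ * fromℤ i * V + Pᵏ * fromℤ j * U
      ≡⟨ solve 5 (λ Q I J U V → Q :* I :* V :+ Q :* J :* U := Q :* (I :* V :+ J :* U)) refl Pᵏ (fromℤ i) (fromℤ j) U V ⟩
    Pᵏ * (fromℤ i * V + fromℤ j * U)                   ≡⟨ cong (Pᵏ *_) (cong₂ _+_ (fromℤ-* i (+ v)) (fromℤ-* j (+ u))) ⟨
    Pᵏ * (fromℤ (i ℤ.* + v) + fromℤ (j ℤ.* + u))       ≡⟨ cong (Pᵏ *_) (fromℤ-+ (i ℤ.* + v) (j ℤ.* + u)) ⟨
    Pᵏ * fromℤ (i ℤ.* + v ℤ.+ j ℤ.* + u)               ∎)
    where
    open ≡-Reasoning
    U V Pᵏ : ℚ
    U = fromℕ u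
    V = fromℕ v
    Pᵏ = fromℕ (p ^ k)

  ≤ᵥ-sumFrom1 : ∀ {k} n {f} → (∀ {m} → 1 ≤ m → m ≤ n → k ≤ᵥ f m) → k ≤ᵥ sumFrom1 n f
  ≤ᵥ-sumFrom1 {k} zero    _      = ≤ᵥ-0ℚ k
  ≤ᵥ-sumFrom1     (suc n) k≤ᵥf =
    ≤ᵥ-+ (≤ᵥ-sumFrom1 n (λ 1≤m m≤n → k≤ᵥf 1≤m (ℕₚ.m≤n⇒m≤1+n m≤n))) (k≤ᵥf (s≤s z≤n) ℕₚ.≤-refl)

  ≤ᵥ-cancelˡ : ∀ {k u x} → p ∤ u → k ≤ᵥ fromℕ u * x → k ≤ᵥ x
  ≤ᵥ-cancelˡ {k} {u} {x} p∤u (witness v p∤v z uxv≡) = witness (u ℕ.* v) (∤-* p∤u p∤v) z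
    (trans (cong (x *_) (fromℕ-* u v))
          (trans (solve 3 (λ x U V → x :* (U :* V) := U :* x :* V) refl x (fromℕ u) (fromℕ v)) uxv≡))

  ≤ᵥ⇒∣↥ : ∀ {k x} → k ≤ᵥ x → p ^ k ∣ ℤ.∣ ↥ x ∣
  ≤ᵥ⇒∣↥ {k} {x} (witness u p∤u z xu≡) =
    p^k∣m*n⇒p^k∣m p∤u k ℤ.∣ ↥ x ∣ (subst (p ^ k ∣_) |↥x|u≡ (∣m⇒∣m*n ℤ.∣ ↧ x ∣ (m∣m*n ℤ.∣ z ∣)))
    where
    open ≡-Reasoning
    |↥x|u≡ : p ^ k ℕ.* ℤ.∣ z ∣ ℕ.* ℤ.∣ ↧ x ∣ ≡ ℤ.∣ ↥ x ∣ ℕ.* u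
    |↥x|u≡ = begin
      p ^ k ℕ.* ℤ.∣ z ∣ ℕ.* ℤ.∣ ↧ x ∣          ≡⟨ cong (ℕ._* ℤ.∣ ↧ x ∣) (ℤₚ.abs-* (+ (p ^ k)) z) ⟨
      ℤ.∣ + (p ^ k) ℤ.* z ∣ ℕ.* ℤ.∣ ↧ x ∣       ≡⟨ ℤₚ.abs-* (+ (p ^ k) ℤ.* z) (↧ x) ⟨
      ℤ.∣ + (p ^ k) ℤ.* z ℤ.* ↧ x ∣
        ≡⟨ cong ℤ.∣_∣ (cross-multiply x u (+ (p ^ k) ℤ.* z) (trans xu≡ (sym (fromℤ-* (+ (p ^ k)) z)))) ⟨
      ℤ.∣ ↥ x ℤ.* + u ∣                         ≡⟨ ℤₚ.abs-* (↥ x) (+ u) ⟩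
      ℤ.∣ ↥ x ∣ ℕ.* u                           ∎

module OddPrime (h : ℕ) (isPrime : Prime (suc (h ℕ.+ h))) (p∤80 : suc (h ℕ.+ h) ∤ 80) where
  open Valuation isPrime

  p : ℕ
  p = suc (h ℕ.+ h)

  P : ℚ
  P = fromℕ p

  a b c : ℕ → ℚ
  a m = invSq m
  b m = invSq (p ∸ (m ℕ.+ m))
  c m = invSq (p ∸ m)

  A B C A₂ B₂ C₂ S S₄ : ℚ
  A  = sumFrom1 h a
  B  = sumFrom1 h b
  C  = sumFrom1 h c
  A₂ = sumFrom1 h (λ m → sq (a m))
  B₂ = sumFrom1 h (λ m → sq (b m))
  C₂ = sumFrom1 h (λ m → sq (c m))
  S  = sumFrom1 (h ℕ.+ h) invSq
  S₄ = sumFrom1 (h ℕ.+ h) (λ n → sq (invSq n))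

  alternating-split : sumFrom1 (h ℕ.+ h) altInvSq ≡ (+ 1 / 4) * A - B
  alternating-split = trans (sumFrom1-split-even-reflectedOdd h altInvSq) (cong₂ _+_
    (trans (sumFrom1-cong h (λ 1≤m _ → trans (altInvSq-even 1≤m) (invSq-double 1≤m))) (sumFrom1-*ˡ h (+ 1 / 4) a))
    (trans (sumFrom1-cong h reflected-odd) (sumFrom1-neg h b)))
    where
    reflected-odd : ∀ {m} → 1 ≤ m → m ≤ h → altInvSq (p ∸ (m ℕ.+ m)) ≡ - invSq (p ∸ (m ℕ.+ m))
    reflected-odd {m} _ m≤h rewrite ∸-double-odd m≤h = altInvSq-odd (h ∸ m)

  square-split : S ≡ (+ 1 / 4) * A + B
  square-split = trans (sumFrom1-split-even-reflectedOdd h invSq)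
    (cong (_+ B) (trans (sumFrom1-cong h (λ 1≤m _ → invSq-double 1≤m)) (sumFrom1-*ˡ h (+ 1 / 4) a)))

  fourth-split : S₄ ≡ (+ 1 / 16) * A₂ + B₂
  fourth-split = trans (sumFrom1-split-even-reflectedOdd h (λ n → sq (invSq n)))
    (cong (_+ B₂) (trans (sumFrom1-cong h (λ 1≤m _ → sq-invSq-double 1≤m)) (sumFrom1-*ˡ h (+ 1 / 16) (λ m → sq (a m)))))

  sum-of-terms : sumFrom1 h (λ m → term (a m) (b m) (c m) P) ≡ fromℕ 80 * (sumFrom1 (h ℕ.+ h) altInvSq - (+ 3 / 4) * S)
  sum-of-terms = begin
    sumFrom1 h (λ m → term (a m) (b m) (c m) P)
      ≡⟨ sumFrom1-combination h a b c (λ m → sq (a m)) (λ m → sq (b m)) (λ m → sq (c m)) P ⟩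
    combination A B C A₂ B₂ C₂ P
      ≡⟨ combination-collapse A B C A₂ B₂ C₂ P (trans (sym (sumFrom1-split-reflectedHalf h invSq)) square-split)
                                              (trans (sym (sumFrom1-split-reflectedHalf h (λ n → sq (invSq n)))) fourth-split) ⟩
    fromℕ 80 * ((+ 1 / 4) * A - B - (+ 3 / 4) * ((+ 1 / 4) * A + B))
      ≡⟨ cong₂ (λ alt s → fromℕ 80 * (alt - (+ 3 / 4) * s)) alternating-split square-split ⟨
    fromℕ 80 * (sumFrom1 (h ℕ.+ h) altInvSq - (+ 3 / 4) * S)  ∎
    where open ≡-Reasoning

  3≤ᵥterm : ∀ {m} → 1 ≤ m → m ≤ h → 3 ≤ᵥ term (a m) (b m) (c m) P
  3≤ᵥterm {m} 1≤m m≤h = witness (u ^ 4) (∤-^ p∤u 4) (proj₁ remainder-integral′) (begin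
    term (a m) (b m) (c m) P * fromℕ (u ^ 4)    ≡⟨ cong (term (a m) (b m) (c m) P *_) (denominator-fromℕ {m} {p} (ℕₚ.<⇒≤ 2m<p)) ⟨
    term (a m) (b m) (c m) P * denominator M P  ≡⟨ term-identity (a m) (b m) (c m) M P (invSq-*-sq 1≤m) bJ²≡1 (invSq-∸-*-sq m<p) ⟩
    pow P 3 * remainder M P                     ≡⟨ cong₂ _*_ (sym (fromℕ-^ p 3)) (proj₂ remainder-integral′) ⟩
    fromℕ (p ^ 3) * fromℤ (proj₁ remainder-integral′)  ∎)
    where
    open ≡-Reasoning
    M : ℚ
    M = fromℕ m
    m<p : m < p
    m<p = s≤s (ℕₚ.≤-trans m≤h (ℕₚ.m≤m+n h h))
    2m<p : m ℕ.+ m < p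
    2m<p = s≤s (ℕₚ.+-mono-≤ m≤h m≤h)
    bJ²≡1 : b m * sq (P - (M + M)) ≡ 1ℚ
    bJ²≡1 = subst (λ J → b m * sq (P - J) ≡ 1ℚ) (fromℕ-+ m m) (invSq-∸-*-sq 2m<p)
    u : ℕ
    u = m ℕ.* (p ∸ m) ℕ.* (p ∸ (m ℕ.+ m))
    p∤u : p ∤ u
    p∤u = ∤-* (∤-* (∤-pos-< 1≤m m<p) (∤-∸ 1≤m m<p)) (∤-∸ (ℕₚ.≤-trans 1≤m (ℕₚ.m≤m+n m m)) 2m<p)
    remainder-integral′ : Integral (remainder M P)
    remainder-integral′ = remainder-integral m p

  p³∣numerator : p ^ 3 ∣ ℤ.∣ ↥ (sumFrom1 (h ℕ.+ h) altInvSq - (+ 3 / 4) * S) ∣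
  p³∣numerator = ≤ᵥ⇒∣↥ (≤ᵥ-cancelˡ {x = sumFrom1 (h ℕ.+ h) altInvSq - (+ 3 / 4) * S} p∤80
    (subst (3 ≤ᵥ_) sum-of-terms (≤ᵥ-sumFrom1 h 3≤ᵥterm)))

mainTheorem10 : (p : ℕ) → Prime p → p ≥ 7 →
    sumFrom1 (p ∸ 1) altInvSq ≡ ((+ 3) / 4) * sumFrom1 (p ∸ 1) invSq [modℚ p ^ 3 ]
mainTheorem10 p isPrime p≥7 with prime>2⇒odd isPrime (ℕₚ.≤-trans (s≤s (s≤s (s≤s z≤n))) p≥7)
... | h , refl = OddPrime.p³∣numerator h isPrime (Valuation.≥7⇒∤80 isPrime p≥7)
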